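{- Let $k\geq 2$, $u\geq 1$ and $v\neq 0$ be integers. Then there are infinitely many prime numbers $p$ such that the congruence $uX^k+v\equiv p\pmod{p^2}$ has an integer solution $X$. -}

module Defs where

-- Put L = 3·N!, a = v k L and d = k u aᵏ⁻¹ ≠ 0, so that f(a) = u aᵏ + v = v (d L + 1). A prime p
-- dividing d L + 1 exceeds N (as in Euclid's proof), divides f(a), and −L inverts f′(a) = d modulo p;
-- shifting a by a suitable multiple of p then turns f(a) ≡ 0 into f(X) ≡ p (mod p²).
module Submission where

open import Defs
open import Data.Nat using (ℕ; _≤_; _<_)
open import Data.Nat.Primality using (Prime)
open import Data.Integer using (ℤ; +_; _+_; _-_; _*_; _^_; 0ℤ; 1ℤ)
open import Data.Integer.Divisibility using (_∣_)
open import Data.Product using (∃-syntax; _×_)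
open import Relation.Binary.PropositionalEquality using (_≢_)

open import Data.Nat as ℕ using (zero; suc; s≤s; z≤n; _!)
import Data.Nat.Properties as ℕ
import Data.Nat.Divisibility as ℕ
open import Data.Nat.Primality using (¬prime[1]; prime⇒nonZero)
open import Data.Nat.Primality.Factorisation using (factorise)
open import Data.Integer using (-[1+_]; ∣_∣)
import Data.Integer.Properties as ℤ
import Data.Integer.Divisibility.Signed as Signed
open import Data.Integer.Tactic.RingSolver using (solve-∀)
open import Data.List using ([]; _∷_)
open import Data.List.Relation.Unary.All using (_∷_)
open import Data.Product using (_,_; proj₁; proj₂)
open import Data.Sum using ([_,_]′)
open import Data.Empty using (⊥-elim)
open import Function using (_∘_)
open import Relation.Binary.PropositionalEquality
  using (_≡_; refl; sym; cong; cong₂; subst; ≢-sym; module ≡-Reasoning)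
open import Relation.Nullary using (yes; no)

binomial-linear : ∀ a b j →
  ∃[ c ] ((a + b) ^ suc j ≡ a * a ^ j + + suc j * a ^ j * b + b * b * c)
binomial-linear a b zero = 0ℤ , expand₀ a b
  where
  expand₀ : ∀ a b → (a + b) * 1ℤ ≡ a * 1ℤ + 1ℤ * 1ℤ * b + b * b * 0ℤ
  expand₀ = solve-∀
binomial-linear a b (suc j) =
  let (c , eq) = binomial-linear a b j
  in  + suc j * a ^ j + c * (a + b) , (begin
        (a + b) * (a + b) ^ suc j
          ≡⟨ cong ((a + b) *_) eq ⟩
        (a + b) * (a * a ^ j + + suc j * a ^ j * b + b * b * c)
          ≡⟨ expand a b (a ^ j) c (+ suc j) ⟩
        a * (a * a ^ j) + + suc (suc j) * (a * a ^ j) * b + b * b * (+ suc j * a ^ j + c * (a + b)) ∎)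
  where
  open ≡-Reasoning
  expand : ∀ a b A c n →
    (a + b) * (a * A + n * A * b + b * b * c) ≡
    a * (a * A) + (1ℤ + n) * (a * A) * b + b * b * (n * A + c * (a + b))
  expand = solve-∀

-- If f(a) = m p and s f′(a) ≡ −1 (mod p), the witness is X = a + (m − 1) s p.
∃X[p²∣uXᵏ+v-p] : ∀ (u v a s p : ℤ) (j : ℕ) →
  p ∣ u * a ^ suc j + v → p ∣ + suc j * u * a ^ j * s + 1ℤ →
  ∃[ X ] (p ^ 2 ∣ u * X ^ suc j + v - p)
∃X[p²∣uXᵏ+v-p] u v a s p j p∣f[a] p∣f′[a]s+1
  with Signed.divides m f[a]≡mp ← Signed.∣ᵤ⇒∣ {p} {u * a ^ suc j + v} p∣f[a]
     | Signed.divides r f′[a]s+1≡rp ← Signed.∣ᵤ⇒∣ {p} {+ suc j * u * a ^ j * s + 1ℤ} p∣f′[a]s+1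
  = X , Signed.∣⇒∣ᵤ (Signed.divides (r * (m - 1ℤ) + u * c * t * t) f[X]-p≡Wp²)
  where
  open ≡-Reasoning
  t = (m - 1ℤ) * s
  X = a + t * p
  A = a ^ j
  k = + suc j
  expansion = binomial-linear a (t * p) j
  c = proj₁ expansion
  regroup : ∀ u v a A s p m c k →
    u * (a * A + k * A * ((m - 1ℤ) * s * p) + (m - 1ℤ) * s * p * ((m - 1ℤ) * s * p) * c) + v - p ≡
    (u * (a * A) + v) + (k * u * A * s + 1ℤ) * (m - 1ℤ) * p
      + u * c * ((m - 1ℤ) * s) * ((m - 1ℤ) * s) * (p * p) - m * p
  regroup = solve-∀
  collect : ∀ p m r e →
    m * p + r * p * (m - 1ℤ) * p + e * (p * p) - m * p ≡ (r * (m - 1ℤ) + e) * (p * (p * 1ℤ))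
  collect = solve-∀
  shape : ℤ → ℤ → ℤ
  shape f[a] f′[a]s+1 = f[a] + f′[a]s+1 * (m - 1ℤ) * p + u * c * t * t * (p * p) - m * p
  f[X]-p≡Wp² : u * X ^ suc j + v - p ≡ (r * (m - 1ℤ) + u * c * t * t) * p ^ 2
  f[X]-p≡Wp² = begin
    u * X ^ suc j + v - p
      ≡⟨ cong (λ y → u * y + v - p) (proj₂ expansion) ⟩
    u * (a * A + k * A * (t * p) + t * p * (t * p) * c) + v - p
      ≡⟨ regroup u v a A s p m c k ⟩
    shape (u * (a * A) + v) (k * u * A * s + 1ℤ)
      ≡⟨ cong₂ shape f[a]≡mp f′[a]s+1≡rp ⟩
    shape (m * p) (r * p)
      ≡⟨ collect p m r (u * c * t * t) ⟩
    (r * (m - 1ℤ) + u * c * t * t) * p ^ 2 ∎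

∃prime∣ : ∀ {n} → 2 ≤ n → ∃[ p ] (Prime p × p ℕ.∣ n)
∃prime∣ {suc m} 2≤n with factorise (suc m)
∃prime∣ {1} (s≤s ()) | record { factors = [] ; isFactorisation = refl }
... | record { factors = p ∷ _ ; isFactorisation = eq ; factorsPrime = p-prime ∷ _ } =
  p , p-prime , subst (p ℕ.∣_) (sym eq) (ℕ.m∣m*n _)

∣n! : ∀ {m n} .{{_ : ℕ.NonZero m}} → m ≤ n → m ℕ.∣ n !
∣n! {suc r} m≤n = ℕ.∣-trans (ℕ.m∣m*n (r !)) (ℕ.m≤n⇒m!∣n! m≤n)

3≤∣i∣⇒2≤∣i+1∣ : ∀ {i} → 3 ≤ ∣ i ∣ → 2 ≤ ∣ i + 1ℤ ∣
3≤∣i∣⇒2≤∣i+1∣ {+ n} 3≤n = ℕ.≤-trans (ℕ.n≤1+n 2) (ℕ.≤-trans 3≤n (ℕ.m≤m+n n 1))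
3≤∣i∣⇒2≤∣i+1∣ { -[1+ suc (suc n) ]} _ = s≤s (s≤s z≤n)
3≤∣i∣⇒2≤∣i+1∣ { -[1+ 0 ]} (s≤s ())
3≤∣i∣⇒2≤∣i+1∣ { -[1+ 1 ]} (s≤s (s≤s ()))

i*j≢0 : ∀ {i j} → i ≢ 0ℤ → j ≢ 0ℤ → i * j ≢ 0ℤ
i*j≢0 {i} i≢0 j≢0 = [ i≢0 , j≢0 ]′ ∘ ℤ.i*j≡0⇒i≡0∨j≡0 i

prime∣d*L+1⇒n<p : ∀ {n L p} d → n ! ℕ.∣ L → Prime p → + p ∣ d * + L + 1ℤ → n < p
prime∣d*L+1⇒n<p {n} {L} {p} d n!∣L p-prime p∣dL+1 with n ℕ.<? p
... | yes n<p = n<p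
... | no n≮p = ⊥-elim (¬prime[1] (subst Prime (ℕ.∣1⇒≡1 (Signed.∣⇒∣ᵤ {+ p} p∣1)) p-prime))
  where
  p∣L : p ℕ.∣ L
  p∣L = ℕ.∣-trans (∣n! {{prime⇒nonZero p-prime}} (ℕ.≮⇒≥ n≮p)) n!∣L
  p∣1 : + p Signed.∣ 1ℤ
  p∣1 = Signed.∣m+n∣m⇒∣n (Signed.∣ᵤ⇒∣ {+ p} p∣dL+1) (Signed.∣n⇒∣m*n d (Signed.∣ᵤ⇒∣ {+ p} {+ L} p∣L))

∃prime>n∣d*L+1 : ∀ n {L} d → n ! ℕ.∣ L → 3 ≤ L → d ≢ 0ℤ →
  ∃[ p ] (n < p × Prime p × + p ∣ d * + L + 1ℤ)
∃prime>n∣d*L+1 n {L} d n!∣L 3≤L d≢0 =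
  let (p , p-prime , p∣dL+1) = ∃prime∣ (3≤∣i∣⇒2≤∣i+1∣ {d * + L} 3≤∣dL∣)
  in  p , prime∣d*L+1⇒n<p d n!∣L p-prime p∣dL+1 , p-prime , p∣dL+1
  where
  1≤∣d∣ : 1 ≤ ∣ d ∣
  1≤∣d∣ = ℕ.n≢0⇒n>0 (d≢0 ∘ ℤ.∣i∣≡0⇒i≡0)
  3≤∣dL∣ : 3 ≤ ∣ d * + L ∣
  3≤∣dL∣ = subst (3 ≤_) (sym (ℤ.abs-* d (+ L))) (ℕ.*-mono-≤ 1≤∣d∣ 3≤L)

lemma1 : (k : ℕ) → 2 ≤ k → (u : ℤ) → 1ℤ Data.Integer.≤ u → (v : ℤ) → v ≢ 0ℤ →
    ∀ (N : ℕ) → ∃[ p ] (N < p × Prime p × ∃[ X ] ((+ p) ^ 2 ∣ (u * X ^ k + v - + p)))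
lemma1 (suc j) _ u 1≤u v v≢0 N =
  let (p , N<p , p-prime , p∣dL+1) = ∃prime>n∣d*L+1 N d (ℕ.n∣m*n 3) 3≤L d≢0
  in  p , N<p , p-prime , ∃X[p²∣uXᵏ+v-p] u v a (+ L) (+ p) j (p∣dL+1⇒p∣f[a] p∣dL+1) p∣dL+1
  where
  L = 3 ℕ.* N !
  a = v * (+ suc j * + L)
  d = + suc j * u * a ^ j
  3≤L : 3 ≤ L
  3≤L = ℕ.*-monoʳ-≤ 3 (ℕ.1≤n! N)
  u≢0 : u ≢ 0ℤ
  u≢0 = ≢-sym (ℤ.<⇒≢ (ℤ.<-≤-trans (Data.Integer.+<+ (s≤s z≤n)) 1≤u))
  a≢0 : a ≢ 0ℤ
  a≢0 = i*j≢0 v≢0 (i*j≢0 {+ suc j} (λ ()) (ℕ.m<n⇒n≢0 3≤L ∘ ℤ.+-injective))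
  d≢0 : d ≢ 0ℤ
  d≢0 = i*j≢0 (i*j≢0 {+ suc j} (λ ()) u≢0) (a≢0 ∘ ℤ.i^n≡0⇒i≡0 a j)
  factor : ∀ u v k L A → u * (v * (k * L) * A) + v ≡ v * (k * u * A * L + 1ℤ)
  factor = solve-∀
  p∣dL+1⇒p∣f[a] : ∀ {p} → + p ∣ d * + L + 1ℤ → + p ∣ u * a ^ suc j + v
  p∣dL+1⇒p∣f[a] {p} p∣dL+1 = subst (+ p ∣_) (sym (factor u v (+ suc j) (+ L) (a ^ j)))
    (Signed.∣⇒∣ᵤ {+ p} (Signed.∣n⇒∣m*n v (Signed.∣ᵤ⇒∣ {+ p} p∣dL+1)))
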